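{- Let $i,j\geq1$ and $k\geq0$ be integers and let $Q_{i,j}^{(k)}=U^{k+i}D^iU^jD^{j+k}$. Let $\Delta(Q_{i,j}^{(k)})$ be the number of elements covered by $Q_{i,j}^{(k)}$ in the Dyck pattern poset. Then $\Delta(Q_{i,j}^{(k)})=1$ if $(i,j,k)=(1,1,0)$; $\Delta(Q_{i,j}^{(k)})=2$ if $(i,j,k)$ is of the form $(i,1,0)$ or $(1,j,0)$ with $i,j\geq2$, or $(1,1,k)$ with $k\geq1$; $\Delta(Q_{i,j}^{(k)})=3$ if $(i,j,k)$ is of the form $(i,j,0)$ with $i,j\geq2$, or $(i,1,k)$ or $(1,j,k)$ with $i,j\geq2$, $k\geq1$; $\Delta(Q_{i,j}^{(k)})=4$ if $i,j\geq2$ and $k\geq1$.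
   Context: A Dyck path is a word over $\{U,D\}$ with equally many $U$'s and $D$'s such that every prefix has at least as many $U$'s as $D$'s; its semilength is its number of $U$'s. The Dyck pattern poset is the set of nonempty Dyck paths ordered by $P\leq Q$ iff $P$ is a subword of $Q$ (obtained by deleting letters, not necessarily consecutive); it is graded by semilength, so $Q$ covers $P$ iff $P\leq Q$ and the semilength of $P$ is one less than that of $Q$. $U^a$ denotes $a$ consecutive $U$'s. -}

module Defs where

open import Data.Nat using (ℕ; zero; suc; _+_; _≤_)
open import Data.List using (List; []; _∷_; _++_; length; replicate)
open import Data.List.Relation.Binary.Sublist.Propositional using (_⊆_)
open import Data.List.Relation.Unary.Unique.Propositional using (Unique)
open import Data.List.Membership.Propositional using (_∈_)
open import Data.Product using (Σ; _×_)
open import Function.Bundles using (_⇔_)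
open import Relation.Binary.PropositionalEquality using (_≡_)

data Step : Set where
  U D : Step

Word : Set
Word = List Step

#U : Word → ℕ
#U []       = 0
#U (U ∷ w)  = suc (#U w)
#U (D ∷ w)  = #U w

#D : Word → ℕ
#D []       = 0
#D (U ∷ w)  = #D w
#D (D ∷ w)  = suc (#D w)

semilength : Word → ℕ
semilength = #U

record IsDyck (w : Word) : Set where
  field
    balanced : #U w ≡ #D w
    prefixes : ∀ (p s : Word) → p ++ s ≡ w → #D p ≤ #U p

record IsPosetElem (w : Word) : Set where
  field
    dyck     : IsDyck w
    nonempty : 1 ≤ semilength w

record Covers (Q P : Word) : Set where
  field
    elemP   : IsPosetElem P
    elemQ   : IsPosetElem Q
    subword : P ⊆ Q
    graded  : suc (semilength P) ≡ semilength Q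

-- Δ Q has value n: the set of elements covered by Q has exactly n elements,
-- i.e. it is listed without repetition by a list of length n.
CoveredCount : Word → ℕ → Set
CoveredCount Q n =
  Σ (List Word) λ L → Unique L × length L ≡ n × (∀ P → (P ∈ L) ⇔ Covers Q P)

Qw : ℕ → ℕ → ℕ → Word
Qw i j k = replicate (k + i) U ++ replicate i D ++ replicate j U ++ replicate (j + k) D

-- A subword of U^a D^b U^c D^d is U^a′ D^b′ U^c′ D^d′ with smaller exponents. If it has one U
-- fewer, exactly one of a, c drops by one, and balance forces exactly one of b, d to drop by
-- one; such a word with a′ + c′ = b′ + d′ is a Dyck path iff b′ ≤ a′. For Q = U^(k+i) D^i U^j D^(j+k)
-- this leaves four candidates: shrink the first peak, shrink the second, raise the valley, or
-- lower it, the last being a Dyck path iff k ≥ 1. Raising the valley is shrinking the first peak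
-- when i = 1 and the second when j = 1 (so all three coincide when i = j = 1); all other
-- candidates differ in the length of their first ascent or first descent.

module Submission where

open import Defs
open import Data.Nat using (ℕ; zero; suc; _+_; _≤_; z≤n; s≤s)
open import Data.Nat.Properties
  using (+-suc; +-identityʳ; +-assoc; +-cancelˡ-≡; suc-injective; ≤-refl; ≤-trans;
         n≤1+n; m≤n⇒m≤1+n; m≤n+m; 1+n≰n; 1+n≢n; m+1+n≢m; m+n≮n; m≤n⇒∃[o]m+o≡n)
open import Data.Nat.Tactic.RingSolver using (solve-∀)
open import Data.List using (List; []; _∷_; _++_; length; replicate)
open import Data.List.Properties using (++-assoc; ∷-injectiveʳ)
open import Data.List.Relation.Binary.Sublist.Propositional using (_⊆_; []; _∷_; _∷ʳ_)
open import Data.List.Relation.Binary.Sublist.Propositional.Properties using (++⁺)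
open import Data.List.Relation.Unary.Any using (here; there)
open import Data.List.Relation.Unary.All using ([]; _∷_)
open import Data.List.Relation.Unary.AllPairs using ([]; _∷_)
open import Data.List.Relation.Unary.Unique.Propositional using (Unique)
open import Data.List.Membership.Propositional using (_∈_)
open import Data.Product using (_×_; _,_; proj₁; proj₂; ∃; ∃₂)
open import Data.Sum using (_⊎_; inj₁; inj₂)
open import Data.Unit using (⊤)
open import Data.Empty using (⊥; ⊥-elim)
open import Function using (_∘_)
open import Function.Bundles using (mk⇔)
open import Relation.Binary.PropositionalEquality
  using (_≡_; _≢_; refl; sym; trans; cong; subst; ≢-sym; module ≡-Reasoning)

UDUD : ℕ → ℕ → ℕ → ℕ → Word
UDUD a b c d = replicate a U ++ replicate b D ++ replicate c U ++ replicate d D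

#U-++ : ∀ xs ys → #U (xs ++ ys) ≡ #U xs + #U ys
#U-++ []       ys = refl
#U-++ (U ∷ xs) ys = cong suc (#U-++ xs ys)
#U-++ (D ∷ xs) ys = #U-++ xs ys

#D-++ : ∀ xs ys → #D (xs ++ ys) ≡ #D xs + #D ys
#D-++ []       ys = refl
#D-++ (U ∷ xs) ys = #D-++ xs ys
#D-++ (D ∷ xs) ys = cong suc (#D-++ xs ys)

#U-replicate-U : ∀ n → #U (replicate n U) ≡ n
#U-replicate-U zero    = refl
#U-replicate-U (suc n) = cong suc (#U-replicate-U n)

#U-replicate-D : ∀ n → #U (replicate n D) ≡ 0
#U-replicate-D zero    = refl
#U-replicate-D (suc n) = #U-replicate-D n

#D-replicate-U : ∀ n → #D (replicate n U) ≡ 0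
#D-replicate-U zero    = refl
#D-replicate-U (suc n) = #D-replicate-U n

#D-replicate-D : ∀ n → #D (replicate n D) ≡ n
#D-replicate-D zero    = refl
#D-replicate-D (suc n) = cong suc (#D-replicate-D n)

#U-UDUD : ∀ a b c d → #U (UDUD a b c d) ≡ a + c
#U-UDUD a b c d
  rewrite #U-++ (replicate a U) (replicate b D ++ replicate c U ++ replicate d D)
        | #U-++ (replicate b D) (replicate c U ++ replicate d D)
        | #U-++ (replicate c U) (replicate d D)
        | #U-replicate-U a | #U-replicate-D b | #U-replicate-U c | #U-replicate-D d
        = cong (a +_) (+-identityʳ c)

#D-UDUD : ∀ a b c d → #D (UDUD a b c d) ≡ b + d
#D-UDUD a b c d
  rewrite #D-++ (replicate a U) (replicate b D ++ replicate c U ++ replicate d D)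
        | #D-++ (replicate b D) (replicate c U ++ replicate d D)
        | #D-++ (replicate c U) (replicate d D)
        | #D-replicate-U a | #D-replicate-D b | #D-replicate-U c | #D-replicate-D d
        = refl

Ballot : ℕ → Word → Set
Ballot h       []      = ⊤
Ballot h       (U ∷ w) = Ballot (suc h) w
Ballot zero    (D ∷ w) = ⊥
Ballot (suc h) (D ∷ w) = Ballot h w

Ballot-prefix : ∀ h p {s} → Ballot h (p ++ s) → #D p ≤ h + #U p
Ballot-prefix h       []      _ = z≤n
Ballot-prefix h       (U ∷ p) b = subst (#D p ≤_) (sym (+-suc h (#U p))) (Ballot-prefix (suc h) p b)
Ballot-prefix (suc h) (D ∷ p) b = s≤s (Ballot-prefix h p b)

Ballot-replicate-U : ∀ n {h w} → Ballot (h + n) w → Ballot h (replicate n U ++ w)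
Ballot-replicate-U zero    {h} {w} b = subst (λ h → Ballot h w) (+-identityʳ h) b
Ballot-replicate-U (suc n) {h} {w} b = Ballot-replicate-U n (subst (λ h → Ballot h w) (+-suc h n) b)

Ballot-replicate-D : ∀ n {h w} → Ballot h w → Ballot (n + h) (replicate n D ++ w)
Ballot-replicate-D zero    b = b
Ballot-replicate-D (suc n) b = Ballot-replicate-D n b

Ballot-replicate-D-end : ∀ n → Ballot n (replicate n D)
Ballot-replicate-D-end zero    = _
Ballot-replicate-D-end (suc n) = Ballot-replicate-D-end n

Ballot⇒IsDyck : ∀ {w} → #U w ≡ #D w → Ballot 0 w → IsDyck w
Ballot⇒IsDyck balanced b = record
  { balanced = balanced
  ; prefixes = λ p s p++s≡w → Ballot-prefix 0 p (subst (Ballot 0) (sym p++s≡w) b)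
  }

UDUD-isDyck : ∀ {a b c d} → b ≤ a → a + c ≡ b + d → IsDyck (UDUD a b c d)
UDUD-isDyck {a} {b} {c} {d} b≤a a+c≡b+d with m≤n⇒∃[o]m+o≡n b≤a
... | e , refl = Ballot⇒IsDyck balanced
  (Ballot-replicate-U (b + e) (Ballot-replicate-D b (Ballot-replicate-U c
    (subst (Ballot (e + c)) (cong (λ n → replicate n D) e+c≡d) (Ballot-replicate-D-end (e + c))))))
  where
  balanced : #U (UDUD (b + e) b c d) ≡ #D (UDUD (b + e) b c d)
  balanced = trans (#U-UDUD (b + e) b c d) (trans a+c≡b+d (sym (#D-UDUD (b + e) b c d)))
  e+c≡d : e + c ≡ d
  e+c≡d = +-cancelˡ-≡ b (e + c) d (trans (sym (+-assoc b e c)) a+c≡b+d)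

UDUD-isDyck⇒≤ : ∀ a b c d → IsDyck (UDUD a b c d) → b ≤ a
UDUD-isDyck⇒≤ a b c d dyck
  with IsDyck.prefixes dyck (replicate a U ++ replicate b D) (replicate c U ++ replicate d D)
                        (++-assoc (replicate a U) (replicate b D) _)
... | b≤a
  rewrite #D-++ (replicate a U) (replicate b D) | #U-++ (replicate a U) (replicate b D)
        | #D-replicate-U a | #D-replicate-D b | #U-replicate-U a | #U-replicate-D b
        | +-identityʳ a
        = b≤a

UDUD-isDyck⇒balanced : ∀ a b c d → IsDyck (UDUD a b c d) → a + c ≡ b + d
UDUD-isDyck⇒balanced a b c d dyck =
  trans (sym (#U-UDUD a b c d)) (trans (IsDyck.balanced dyck) (#D-UDUD a b c d))

UDUD-isPosetElem : ∀ {a b c d} → b ≤ a → a + c ≡ b + d → 1 ≤ a + c → IsPosetElem (UDUD a b c d)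
UDUD-isPosetElem {a} {b} {c} {d} b≤a a+c≡b+d 1≤a+c = record
  { dyck     = UDUD-isDyck b≤a a+c≡b+d
  ; nonempty = subst (1 ≤_) (sym (#U-UDUD a b c d)) 1≤a+c
  }

replicate-++-∷ : ∀ {A : Set} n (x : A) xs → replicate n x ++ x ∷ xs ≡ x ∷ replicate n x ++ xs
replicate-++-∷ zero    x xs = refl
replicate-++-∷ (suc n) x xs = cong (x ∷_) (replicate-++-∷ n x xs)

replicate-++-replicate : ∀ {A : Set} m n (x : A) xs →
                         replicate m x ++ replicate n x ++ xs ≡ replicate (m + n) x ++ xs
replicate-++-replicate zero    n x xs = refl
replicate-++-replicate (suc m) n x xs = cong (x ∷_) (replicate-++-replicate m n x xs)

replicate-++-∷-injective : ∀ {A : Set} {x y : A} m n {xs ys} → x ≢ y →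
                           replicate m x ++ y ∷ xs ≡ replicate n x ++ y ∷ ys → m ≡ n × xs ≡ ys
replicate-++-∷-injective zero    zero    x≢y refl = refl , refl
replicate-++-∷-injective zero    (suc n) x≢y refl = ⊥-elim (x≢y refl)
replicate-++-∷-injective (suc m) zero    x≢y refl = ⊥-elim (x≢y refl)
replicate-++-∷-injective (suc m) (suc n) x≢y eq with replicate-++-∷-injective m n x≢y (∷-injectiveʳ eq)
... | refl , refl = refl , refl

replicate⁺ : ∀ {A : Set} {m n} (x : A) → m ≤ n → replicate m x ⊆ replicate n x
replicate⁺ {n = zero}  x z≤n       = []
replicate⁺ {n = suc n} x z≤n       = x ∷ʳ replicate⁺ x z≤n
replicate⁺             x (s≤s m≤n) = refl ∷ replicate⁺ x m≤n

replicate-++⁻ : ∀ {A : Set} n {x : A} {xs ys} → ys ⊆ replicate n x ++ xs →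
                ∃₂ λ m ys′ → m ≤ n × ys′ ⊆ xs × ys ≡ replicate m x ++ ys′
replicate-++⁻ zero p = 0 , _ , z≤n , p , refl
replicate-++⁻ (suc n) (_ ∷ʳ p) with replicate-++⁻ n p
... | m , ys′ , m≤n , p′ , refl = m , ys′ , m≤n⇒m≤1+n m≤n , p′ , refl
replicate-++⁻ (suc n) (refl ∷ p) with replicate-++⁻ n p
... | m , ys′ , m≤n , p′ , refl = suc m , ys′ , s≤s m≤n , p′ , refl

replicate⁻ : ∀ {A : Set} n {x : A} {ys} → ys ⊆ replicate n x → ∃ λ m → m ≤ n × ys ≡ replicate m x
replicate⁻ zero [] = 0 , z≤n , refl
replicate⁻ (suc n) (_ ∷ʳ p) with replicate⁻ n p
... | m , m≤n , refl = m , m≤n⇒m≤1+n m≤n , refl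
replicate⁻ (suc n) (refl ∷ p) with replicate⁻ n p
... | m , m≤n , refl = suc m , s≤s m≤n , refl

UDUD-⊆⁺ : ∀ {a b c d a′ b′ c′ d′} → a′ ≤ a → b′ ≤ b → c′ ≤ c → d′ ≤ d → UDUD a′ b′ c′ d′ ⊆ UDUD a b c d
UDUD-⊆⁺ a′≤a b′≤b c′≤c d′≤d =
  ++⁺ (replicate⁺ U a′≤a) (++⁺ (replicate⁺ D b′≤b) (++⁺ (replicate⁺ U c′≤c) (replicate⁺ D d′≤d)))

data SubUDUD (a b c d : ℕ) : Word → Set where
  sub : ∀ {a′ b′ c′ d′} → a′ ≤ a → b′ ≤ b → c′ ≤ c → d′ ≤ d → SubUDUD a b c d (UDUD a′ b′ c′ d′)

UDUD-⊆⁻ : ∀ a b c d {P} → P ⊆ UDUD a b c d → SubUDUD a b c d P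
UDUD-⊆⁻ a b c d p with replicate-++⁻ a p
... | _ , _ , a′≤a , p₁ , refl with replicate-++⁻ b p₁
... | _ , _ , b′≤b , p₂ , refl with replicate-++⁻ c p₂
... | _ , _ , c′≤c , p₃ , refl with replicate⁻ d p₃
... | _ , d′≤d , refl = sub a′≤a b′≤b c′≤c d′≤d

data OneLess : ℕ → ℕ → ℕ → ℕ → Set where
  left  : ∀ {a c} → OneLess (suc a) c a c
  right : ∀ {a c} → OneLess a (suc c) a c

OneLess-≤ : ∀ {a c a′ c′} → OneLess a c a′ c′ → a′ ≤ a × c′ ≤ c
OneLess-≤ {a′ = a′} left  = n≤1+n a′ , ≤-refl
OneLess-≤ {c′ = c′} right = ≤-refl , n≤1+n c′

OneLess-sum : ∀ {a c a′ c′} → OneLess a c a′ c′ → suc (a′ + c′) ≡ a + c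
OneLess-sum left = refl
OneLess-sum {a} {suc c} right = sym (+-suc a c)

OneLess-suc : ∀ {a c a′ c′} → OneLess a c a′ c′ → OneLess (suc a) c (suc a′) c′
OneLess-suc left  = left
OneLess-suc right = right

oneLess : ∀ {a c a′ c′} → a′ ≤ a → c′ ≤ c → suc (a′ + c′) ≡ a + c → OneLess a c a′ c′
oneLess {zero}        z≤n _ refl = right
oneLess {suc zero}    z≤n _ refl = left
oneLess {suc (suc a)} {c} z≤n c′≤c refl = ⊥-elim (m+n≮n a c c′≤c)
oneLess (s≤s a′≤a) c′≤c eq = OneLess-suc (oneLess a′≤a c′≤c (suc-injective eq))

data Corner (a b c d : ℕ) : Word → Set where
  corner : ∀ {a′ b′ c′ d′} → OneLess a c a′ c′ → OneLess b d b′ d′ → Corner a b c d (UDUD a′ b′ c′ d′)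

covered⇒Corner : ∀ {a b c d P} → Covers (UDUD a b c d) P → Corner a b c d P
covered⇒Corner {a} {b} {c} {d} cov with UDUD-⊆⁻ a b c d (Covers.subword cov)
... | sub {a′} {b′} {c′} {d′} a′≤a b′≤b c′≤c d′≤d =
  corner (oneLess a′≤a c′≤c ups) (oneLess b′≤b d′≤d downs)
  where
  open ≡-Reasoning
  ups : suc (a′ + c′) ≡ a + c
  ups = begin
    suc (a′ + c′)                   ≡⟨ cong suc (#U-UDUD a′ b′ c′ d′) ⟨
    suc (#U (UDUD a′ b′ c′ d′))     ≡⟨ Covers.graded cov ⟩
    #U (UDUD a b c d)               ≡⟨ #U-UDUD a b c d ⟩
    a + c                           ∎
  downs : suc (b′ + d′) ≡ b + d
  downs = begin
    suc (b′ + d′) ≡⟨ cong suc (UDUD-isDyck⇒balanced a′ b′ c′ d′ (IsPosetElem.dyck (Covers.elemP cov))) ⟨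
    suc (a′ + c′) ≡⟨ ups ⟩
    a + c         ≡⟨ UDUD-isDyck⇒balanced a b c d (IsPosetElem.dyck (Covers.elemQ cov)) ⟩
    b + d         ∎

corner-covered : ∀ {a b c d a′ b′ c′ d′} → IsPosetElem (UDUD a b c d) →
                 OneLess a c a′ c′ → OneLess b d b′ d′ → b′ ≤ a′ → 1 ≤ a′ + c′ →
                 Covers (UDUD a b c d) (UDUD a′ b′ c′ d′)
corner-covered {a} {b} {c} {d} {a′} {b′} {c′} {d′} elemQ ups downs b′≤a′ 1≤a′+c′ = record
  { elemP   = UDUD-isPosetElem b′≤a′ balanced 1≤a′+c′
  ; elemQ   = elemQ
  ; subword = subword (OneLess-≤ ups) (OneLess-≤ downs)
  ; graded  = trans (cong suc (#U-UDUD a′ b′ c′ d′)) (trans (OneLess-sum ups) (sym (#U-UDUD a b c d)))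
  }
  where
  balanced : a′ + c′ ≡ b′ + d′
  balanced = suc-injective (trans (OneLess-sum ups)
    (trans (UDUD-isDyck⇒balanced a b c d (IsPosetElem.dyck elemQ)) (sym (OneLess-sum downs))))
  subword : a′ ≤ a × c′ ≤ c → b′ ≤ b × d′ ≤ d → UDUD a′ b′ c′ d′ ⊆ UDUD a b c d
  subword (a′≤a , c′≤c) (b′≤b , d′≤d) = UDUD-⊆⁺ a′≤a b′≤b c′≤c d′≤d

Q⁺ : ℕ → ℕ → ℕ → Word
Q⁺ i j k = UDUD (suc (k + i)) (suc i) (suc j) (suc (j + k))

Qw≡Q⁺ : ∀ i j k → Qw (suc i) (suc j) k ≡ Q⁺ i j k
Qw≡Q⁺ i j k = cong (λ n → UDUD n (suc i) (suc j) (suc (j + k))) (+-suc k i)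

Q⁺-isPosetElem : ∀ i j k → IsPosetElem (Q⁺ i j k)
Q⁺-isPosetElem i j k = UDUD-isPosetElem (s≤s (m≤n+m i k)) (balanced k i j) (s≤s z≤n)
  where
  balanced : ∀ k i j → suc (k + i) + suc j ≡ suc i + suc (j + k)
  balanced = solve-∀

shrinkFirstPeak shrinkSecondPeak raiseValley lowerValley : ℕ → ℕ → ℕ → Word
shrinkFirstPeak  i j k = UDUD (k + i)       i       (suc j) (suc (j + k))
shrinkSecondPeak i j k = UDUD (suc (k + i)) (suc i) j       (j + k)
raiseValley      i j k = UDUD (suc (k + i)) i       j       (suc (j + k))
lowerValley      i j k = UDUD (k + i)       (suc i) (suc j) (j + k)

data Cover (i j : ℕ) : ℕ → Word → Set where
  first   : ∀ {k} → Cover i j k (shrinkFirstPeak i j k)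
  second  : ∀ {k} → Cover i j k (shrinkSecondPeak i j k)
  raised  : ∀ {k} → Cover i j k (raiseValley i j k)
  lowered : ∀ {k} → Cover i j (suc k) (lowerValley i j (suc k))

lowerValley-cover : ∀ {i j} k → IsDyck (lowerValley i j k) → Cover i j k (lowerValley i j k)
lowerValley-cover {i} {j} zero    dyck = ⊥-elim (1+n≰n (UDUD-isDyck⇒≤ i (suc i) (suc j) (j + 0) dyck))
lowerValley-cover         (suc k) _    = lowered

covers⇒Cover : ∀ {i j k P} → Covers (Qw (suc i) (suc j) k) P → Cover i j k P
covers⇒Cover {i} {j} {k} cov
  with covered⇒Corner {suc (k + i)} {suc i} {suc j} {suc (j + k)} (subst (λ Q → Covers Q _) (Qw≡Q⁺ i j k) cov)
... | corner left  left  = first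
... | corner right right = second
... | corner right left  = raised
... | corner left  right = lowerValley-cover k (IsPosetElem.dyck (Covers.elemP cov))

Cover⇒covers : ∀ {i j k P} → Cover i j k P → Covers (Qw (suc i) (suc j) k) P
Cover⇒covers {i} {j} {k} cover = subst (λ Q → Covers Q _) (sym (Qw≡Q⁺ i j k)) (coversQ⁺ cover)
  where
  cornerQ⁺ : ∀ k {a′ b′ c′ d′} → OneLess (suc (k + i)) (suc j) a′ c′ → OneLess (suc i) (suc (j + k)) b′ d′ →
             b′ ≤ a′ → 1 ≤ a′ + c′ → Covers (Q⁺ i j k) (UDUD a′ b′ c′ d′)
  cornerQ⁺ k = corner-covered (Q⁺-isPosetElem i j k)
  coversQ⁺ : ∀ {k P} → Cover i j k P → Covers (Q⁺ i j k) P
  coversQ⁺ {k}     first   = cornerQ⁺ k left left (m≤n+m i k) (≤-trans (s≤s z≤n) (m≤n+m (suc j) (k + i)))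
  coversQ⁺ {k}     second  = cornerQ⁺ k right right (s≤s (m≤n+m i k)) (s≤s z≤n)
  coversQ⁺ {k}     raised  = cornerQ⁺ k right left (m≤n⇒m≤1+n (m≤n+m i k)) (s≤s z≤n)
  coversQ⁺ {suc k} lowered = cornerQ⁺ (suc k) left right (s≤s (m≤n+m i k)) (s≤s z≤n)

coveredCount : ∀ {i j k} (L : List Word) → Unique L →
               (∀ {P} → P ∈ L → Cover i j k P) → (∀ {P} → Cover i j k P → P ∈ L) →
               CoveredCount (Qw (suc i) (suc j) k) (length L)
coveredCount L unique sound complete =
  L , unique , refl , λ P → mk⇔ (Cover⇒covers ∘ sound) (complete ∘ covers⇒Cover)

differentAscent : ∀ m n {xs ys} → m ≢ n → replicate m U ++ D ∷ xs ≢ replicate n U ++ D ∷ ys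
differentAscent m n m≢n = m≢n ∘ proj₁ ∘ replicate-++-∷-injective m n (λ ())

differentDescent : ∀ a m n {xs ys} → m ≢ n →
                   replicate a U ++ D ∷ replicate m D ++ U ∷ xs ≢ replicate a U ++ D ∷ replicate n D ++ U ∷ ys
differentDescent a m n m≢n =
  m≢n ∘ proj₁ ∘ replicate-++-∷-injective m n (λ ()) ∘ proj₂ ∘ replicate-++-∷-injective a a (λ ())

raiseValley≡shrinkFirstPeak : ∀ j k → raiseValley 0 j k ≡ shrinkFirstPeak 0 j k
raiseValley≡shrinkFirstPeak j k = sym (replicate-++-∷ (k + 0) U _)

raiseValley≡shrinkSecondPeak : ∀ i k → raiseValley i 0 k ≡ shrinkSecondPeak i 0 k
raiseValley≡shrinkSecondPeak i k = cong (replicate (suc (k + i)) U ++_) (replicate-++-∷ i D _)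

Δ-1-1-0 : CoveredCount (Qw 1 1 0) 1
Δ-1-1-0 = coveredCount (shrinkFirstPeak 0 0 0 ∷ []) ([] ∷ []) sound complete
  where
  sound : ∀ {P} → P ∈ shrinkFirstPeak 0 0 0 ∷ [] → Cover 0 0 0 P
  sound (here refl) = first
  complete : ∀ {P} → Cover 0 0 0 P → P ∈ shrinkFirstPeak 0 0 0 ∷ []
  complete first  = here refl
  complete second = here refl
  complete raised = here refl

Δ-i-1-0 : ∀ n → CoveredCount (Qw (2 + n) 1 0) 2
Δ-i-1-0 n = coveredCount L
  ((differentAscent (suc n) (2 + n) (≢-sym 1+n≢n) ∷ []) ∷ [] ∷ []) sound complete
  where
  L = shrinkFirstPeak (suc n) 0 0 ∷ shrinkSecondPeak (suc n) 0 0 ∷ []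
  sound : ∀ {P} → P ∈ L → Cover (suc n) 0 0 P
  sound (here refl)         = first
  sound (there (here refl)) = second
  complete : ∀ {P} → Cover (suc n) 0 0 P → P ∈ L
  complete first  = here refl
  complete second = there (here refl)
  complete raised = there (here (raiseValley≡shrinkSecondPeak (suc n) 0))

Δ-1-j-0 : ∀ m → CoveredCount (Qw 1 (2 + m) 0) 2
Δ-1-j-0 m = coveredCount L
  ((differentAscent (2 + m) 1 (λ ()) ∷ []) ∷ [] ∷ []) sound complete
  where
  L = shrinkFirstPeak 0 (suc m) 0 ∷ shrinkSecondPeak 0 (suc m) 0 ∷ []
  sound : ∀ {P} → P ∈ L → Cover 0 (suc m) 0 P
  sound (here refl)         = first
  sound (there (here refl)) = second
  complete : ∀ {P} → Cover 0 (suc m) 0 P → P ∈ L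
  complete first  = here refl
  complete second = there (here refl)
  complete raised = here (raiseValley≡shrinkFirstPeak (suc m) 0)

Δ-1-1-k : ∀ k → CoveredCount (Qw 1 1 (suc k)) 2
Δ-1-1-k k = coveredCount L
  ((differentAscent (2 + (k + 0)) (1 + (k + 0)) 1+n≢n ∷ []) ∷ [] ∷ []) sound complete
  where
  L = shrinkSecondPeak 0 0 (suc k) ∷ lowerValley 0 0 (suc k) ∷ []
  sound : ∀ {P} → P ∈ L → Cover 0 0 (suc k) P
  sound (here refl)         = second
  sound (there (here refl)) = lowered
  complete : ∀ {P} → Cover 0 0 (suc k) P → P ∈ L
  complete first   = here (trans (sym (raiseValley≡shrinkFirstPeak 0 (suc k)))
                                 (raiseValley≡shrinkSecondPeak 0 (suc k)))
  complete second  = here refl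
  complete raised  = here (raiseValley≡shrinkSecondPeak 0 (suc k))
  complete lowered = there (here refl)

Δ-i-j-0 : ∀ n m → CoveredCount (Qw (2 + n) (2 + m) 0) 3
Δ-i-j-0 n m = coveredCount L
  ((differentAscent (suc n) (2 + n) (≢-sym 1+n≢n) ∷ differentAscent (suc n) (2 + n) (≢-sym 1+n≢n) ∷ []) ∷
   (differentDescent (2 + n) (suc n) n 1+n≢n ∷ []) ∷ [] ∷ []) sound complete
  where
  L = shrinkFirstPeak (suc n) (suc m) 0 ∷ shrinkSecondPeak (suc n) (suc m) 0 ∷ raiseValley (suc n) (suc m) 0 ∷ []
  sound : ∀ {P} → P ∈ L → Cover (suc n) (suc m) 0 P
  sound (here refl)                 = first
  sound (there (here refl))         = second
  sound (there (there (here refl))) = raised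
  complete : ∀ {P} → Cover (suc n) (suc m) 0 P → P ∈ L
  complete first  = here refl
  complete second = there (here refl)
  complete raised = there (there (here refl))

Δ-i-1-k : ∀ n k → CoveredCount (Qw (2 + n) 1 (suc k)) 3
Δ-i-1-k n k = coveredCount L
  ((differentAscent a (suc a) (≢-sym 1+n≢n) ∷ differentDescent a n (suc n) (≢-sym 1+n≢n) ∷ []) ∷
   (differentAscent (suc a) a 1+n≢n ∷ []) ∷ [] ∷ []) sound complete
  where
  a = suc k + suc n
  L = shrinkFirstPeak (suc n) 0 (suc k) ∷ shrinkSecondPeak (suc n) 0 (suc k) ∷ lowerValley (suc n) 0 (suc k) ∷ []
  sound : ∀ {P} → P ∈ L → Cover (suc n) 0 (suc k) P
  sound (here refl)                 = first
  sound (there (here refl))         = second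
  sound (there (there (here refl))) = lowered
  complete : ∀ {P} → Cover (suc n) 0 (suc k) P → P ∈ L
  complete first   = here refl
  complete second  = there (here refl)
  complete raised  = there (here (raiseValley≡shrinkSecondPeak (suc n) (suc k)))
  complete lowered = there (there (here refl))

Δ-1-j-k : ∀ m k → CoveredCount (Qw 1 (2 + m) (suc k)) 3
Δ-1-j-k m k = coveredCount L ((first≢second ∷ first≢lowered ∷ []) ∷
  (differentAscent (2 + x) (suc x) 1+n≢n ∷ []) ∷ [] ∷ []) sound complete
  where
  x = k + 0
  L = shrinkFirstPeak 0 (suc m) (suc k) ∷ shrinkSecondPeak 0 (suc m) (suc k) ∷ lowerValley 0 (suc m) (suc k) ∷ []
  first≢second : shrinkFirstPeak 0 (suc m) (suc k) ≢ shrinkSecondPeak 0 (suc m) (suc k)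
  first≢second eq = differentAscent (2 + x + suc m) (2 + x) (m+1+n≢m (2 + x))
    (trans (sym (replicate-++-replicate (2 + x) (suc m) U _))
      (trans (raiseValley≡shrinkFirstPeak (suc m) (suc k)) eq))
  first≢lowered : shrinkFirstPeak 0 (suc m) (suc k) ≢ lowerValley 0 (suc m) (suc k)
  first≢lowered eq = differentAscent (suc x + (2 + m)) (suc x) (m+1+n≢m (suc x))
    (trans (sym (replicate-++-replicate (suc x) (2 + m) U _)) eq)
  sound : ∀ {P} → P ∈ L → Cover 0 (suc m) (suc k) P
  sound (here refl)                 = first
  sound (there (here refl))         = second
  sound (there (there (here refl))) = lowered
  complete : ∀ {P} → Cover 0 (suc m) (suc k) P → P ∈ L
  complete first   = here refl
  complete second  = there (here refl)
  complete raised  = here (raiseValley≡shrinkFirstPeak (suc m) (suc k))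
  complete lowered = there (there (here refl))

Δ-i-j-k : ∀ n m k → CoveredCount (Qw (2 + n) (2 + m) (suc k)) 4
Δ-i-j-k n m k = coveredCount L
  ((differentAscent a (suc a) (≢-sym 1+n≢n) ∷ differentAscent a (suc a) (≢-sym 1+n≢n) ∷
      differentDescent a n (suc n) (≢-sym 1+n≢n) ∷ []) ∷
   (differentDescent (suc a) (suc n) n 1+n≢n ∷ differentAscent (suc a) a 1+n≢n ∷ []) ∷
   (differentAscent (suc a) a 1+n≢n ∷ []) ∷ [] ∷ []) sound complete
  where
  a = suc k + suc n
  L = shrinkFirstPeak (suc n) (suc m) (suc k) ∷ shrinkSecondPeak (suc n) (suc m) (suc k) ∷
      raiseValley (suc n) (suc m) (suc k) ∷ lowerValley (suc n) (suc m) (suc k) ∷ []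
  sound : ∀ {P} → P ∈ L → Cover (suc n) (suc m) (suc k) P
  sound (here refl)                         = first
  sound (there (here refl))                 = second
  sound (there (there (here refl)))         = raised
  sound (there (there (there (here refl)))) = lowered
  complete : ∀ {P} → Cover (suc n) (suc m) (suc k) P → P ∈ L
  complete first   = here refl
  complete second  = there (here refl)
  complete raised  = there (there (here refl))
  complete lowered = there (there (there (here refl)))

Δ≡1 : ∀ i j k → (i ≡ 1 × j ≡ 1 × k ≡ 0) → CoveredCount (Qw i j k) 1
Δ≡1 _ _ _ (refl , refl , refl) = Δ-1-1-0

Δ≡2 : ∀ i j k → ((2 ≤ i × j ≡ 1 × k ≡ 0) ⊎ (i ≡ 1 × 2 ≤ j × k ≡ 0) ⊎ (i ≡ 1 × j ≡ 1 × 1 ≤ k)) →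
      CoveredCount (Qw i j k) 2
Δ≡2 _ _ _ (inj₁ (s≤s (s≤s z≤n) , refl , refl))        = Δ-i-1-0 _
Δ≡2 _ _ _ (inj₂ (inj₁ (refl , s≤s (s≤s z≤n) , refl))) = Δ-1-j-0 _
Δ≡2 _ _ _ (inj₂ (inj₂ (refl , refl , s≤s z≤n)))       = Δ-1-1-k _

Δ≡3 : ∀ i j k → ((2 ≤ i × 2 ≤ j × k ≡ 0) ⊎ (2 ≤ i × j ≡ 1 × 1 ≤ k) ⊎ (i ≡ 1 × 2 ≤ j × 1 ≤ k)) →
      CoveredCount (Qw i j k) 3
Δ≡3 _ _ _ (inj₁ (s≤s (s≤s z≤n) , s≤s (s≤s z≤n) , refl))   = Δ-i-j-0 _ _
Δ≡3 _ _ _ (inj₂ (inj₁ (s≤s (s≤s z≤n) , refl , s≤s z≤n)))  = Δ-i-1-k _ _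
Δ≡3 _ _ _ (inj₂ (inj₂ (refl , s≤s (s≤s z≤n) , s≤s z≤n)))  = Δ-1-j-k _ _

Δ≡4 : ∀ i j k → (2 ≤ i × 2 ≤ j × 1 ≤ k) → CoveredCount (Qw i j k) 4
Δ≡4 _ _ _ (s≤s (s≤s z≤n) , s≤s (s≤s z≤n) , s≤s z≤n) = Δ-i-j-k _ _ _

mainTheorem8 : ∀ (i j k : ℕ) → 1 ≤ i → 1 ≤ j →
    ((i ≡ 1 × j ≡ 1 × k ≡ 0) → CoveredCount (Qw i j k) 1)
    × (((2 ≤ i × j ≡ 1 × k ≡ 0) ⊎ (i ≡ 1 × 2 ≤ j × k ≡ 0) ⊎ (i ≡ 1 × j ≡ 1 × 1 ≤ k))
        → CoveredCount (Qw i j k) 2)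
    × (((2 ≤ i × 2 ≤ j × k ≡ 0) ⊎ (2 ≤ i × j ≡ 1 × 1 ≤ k) ⊎ (i ≡ 1 × 2 ≤ j × 1 ≤ k))
        → CoveredCount (Qw i j k) 3)
    × ((2 ≤ i × 2 ≤ j × 1 ≤ k) → CoveredCount (Qw i j k) 4)
mainTheorem8 i j k _ _ = Δ≡1 i j k , Δ≡2 i j k , Δ≡3 i j k , Δ≡4 i j k
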